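{- Let $\pi$ be a full permutation of $[n]$, $n\ge 2$, and consider its top-level bracketing under any bracketing process. Then $\pi$ is indecomposable if and only if the top-level bracketing has the form $[m_1,m_2]$; equivalently, $\pi$ is decomposable if and only if the top-level bracketing has the form $(m_1,m_2)$.
   Context: $[n]=\{1,\dots,n\}$; $\pi=a_1\cdots a_n$ in one-line notation. The permutation matrix of $\pi$ has a $1$ in row $n+1-a_j$, column $j$. Bootstrap percolation: a cell is mutable if it contains $0$ and at least two orthogonal neighbours contain $1$; mutable cells are changed to $1$ one at a time until none remain (final result independent of the order); $\pi$ is full if the final configuration is the all-ones matrix. A permutation $\pi$ of $[n]$ is indecomposable if there is no $1\le k<n$ with $\pi(\{1,\dots,k\})=\{1,\dots,k\}$, and decomposable otherwise. Melds: each entry $a_j$ (at position $j$) is a meld with entry set $\{a_j\}$; if $m_1,m_2$ are melds occupying adjacent position intervals, $m_1$ left of $m_2$, with entry sets $E_1,E_2$ whose union is a set of consecutive integers, their merger is $(m_1,m_2)$ if $\max E_1+1=\min E_2$ and $[m_1,m_2]$ if $\min E_1=\max E_2+1$. A bracketing process starts with the singleton melds $a_1,\dots,a_n$ and repeatedly merges some adjacent mergeable pair until none remains. For a full permutation of $[n]$, $n\ge2$, every bracketing process ends in a single meld of the form $(m_1,m_2)$ or $[m_1,m_2]$, called the top-level bracketing. -}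

module Defs where

open import Data.Nat using (ℕ; zero; suc; _∸_; _≤_; _<_)
open import Data.Fin using (Fin; toℕ)
open import Data.Fin.Permutation using (Permutation′; _⟨$⟩ʳ_)
open import Data.Product using (Σ; _×_; _,_; ∃)
open import Data.Sum using (_⊎_)
open import Relation.Binary.PropositionalEquality using (_≡_; _≢_)
open import Relation.Nullary using (¬_)

-- Conventions: positions j are 0-based (position j here = position j+1 in
-- the paper); the entry a_{j+1} of the paper is  suc (toℕ (π ⟨$⟩ʳ j)) ∈ {1..n}.

module _ {n : ℕ} (π : Permutation′ n) where

  entry : Fin n → ℕ
  entry j = suc (toℕ (π ⟨$⟩ʳ j))

  -- π({1,…,k}) = {1,…,k}  (as sets, written with 0-based Fin indices)
  FixesInitialSegment : ℕ → Set
  FixesInitialSegment k =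
    (∀ (j : Fin n) → toℕ j < k → toℕ (π ⟨$⟩ʳ j) < k)
    × (∀ (v : Fin n) → toℕ v < k → Σ (Fin n) λ j → toℕ j < k × π ⟨$⟩ʳ j ≡ v)

  Decomposable : Set
  Decomposable = Σ ℕ λ k → 1 ≤ k × k < n × FixesInitialSegment k

  Indecomposable : Set
  Indecomposable = ¬ Decomposable

  -- 0-based row/column indices.  Paper: 1 in row n+1-a_j, column j (1-based);
  -- 0-based: row n - a = n ∸ suc (toℕ (π j)), column j.
  Initially1 : Fin n → Fin n → Set
  Initially1 r c = toℕ r ≡ n ∸ entry c

  Succ : Fin n → Fin n → Set
  Succ x y = toℕ x ≡ suc (toℕ y)

  Adj : (Fin n × Fin n) → (Fin n × Fin n) → Set
  Adj (r , c) (r' , c') =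
    (r ≡ r' × (Succ c c' ⊎ Succ c' c)) ⊎ (c ≡ c' × (Succ r r' ⊎ Succ r' r))

  -- cells that contain 1 in the final configuration of the percolation:
  -- the least set containing the initial 1s and closed under
  -- "a cell with at least two orthogonal neighbours containing 1 becomes 1".
  data Infected : Fin n × Fin n → Set where
    seed : ∀ {r c} → Initially1 r c → Infected (r , c)
    grow : ∀ {x y z} → Adj x y → Adj x z → y ≢ z →
           Infected y → Infected z → Infected x

  Full : Set
  Full = ∀ (x : Fin n × Fin n) → Infected x

  -- Meld i k lo hi : a meld occupying positions i, …, k-1 (0-based)
  -- whose entry set is {lo, …, hi}.
  data Meld : ℕ → ℕ → ℕ → ℕ → Set where
    single : (j : Fin n) → Meld (toℕ j) (suc (toℕ j)) (entry j) (entry j)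
    -- (m₁ , m₂) : max E₁ + 1 = min E₂
    inc : ∀ {i j k lo mid hi} →
          Meld i j lo mid → Meld j k (suc mid) hi → Meld i k lo hi
    -- [m₁ , m₂] : min E₁ = max E₂ + 1
    dec : ∀ {i j k lo mid hi} →
          Meld i j (suc mid) hi → Meld j k lo mid → Meld i k lo hi

  data Chain : ℕ → ℕ → Set where
    []  : ∀ {i} → Chain i i
    _∷_ : ∀ {i j k lo hi} → Meld i j lo hi → Chain j k → Chain i k

  infixr 5 _∷_

  data AllSingle : ∀ {i k} → Chain i k → Set where
    []  : ∀ {i} → AllSingle ([] {i})
    _∷_ : ∀ {k} (j : Fin n) {c : Chain (suc (toℕ j)) k} →
          AllSingle c → AllSingle (single j ∷ c)

  data Step : ∀ {i k} → Chain i k → Chain i k → Set where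
    merge-inc : ∀ {i j k l lo mid hi}
                (m₁ : Meld i j lo mid) (m₂ : Meld j k (suc mid) hi)
                (rest : Chain k l) →
                Step (m₁ ∷ m₂ ∷ rest) (inc m₁ m₂ ∷ rest)
    merge-dec : ∀ {i j k l lo mid hi}
                (m₁ : Meld i j (suc mid) hi) (m₂ : Meld j k lo mid)
                (rest : Chain k l) →
                Step (m₁ ∷ m₂ ∷ rest) (dec m₁ m₂ ∷ rest)
    there     : ∀ {i j k lo hi} (m : Meld i j lo hi) {c c' : Chain j k} →
                Step c c' → Step (m ∷ c) (m ∷ c')

  data Steps {i k : ℕ} : Chain i k → Chain i k → Set where
    done : ∀ {c} → Steps c c
    step : ∀ {c c' c''} → Step c c' → Steps c' c'' → Steps c c''

  Terminal : ∀ {i k} → Chain i k → Set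
  Terminal c = ∀ c' → ¬ Step c c'

  data SingleMeld : ∀ {i k} → Chain i k → Set where
    one : ∀ {i k lo hi} (m : Meld i k lo hi) → SingleMeld (m ∷ [])

  data TopInc : ∀ {i k} → Chain i k → Set where
    top : ∀ {i j k lo mid hi}
          (m₁ : Meld i j lo mid) (m₂ : Meld j k (suc mid) hi) →
          TopInc (inc m₁ m₂ ∷ [])

  data TopDec : ∀ {i k} → Chain i k → Set where
    top : ∀ {i j k lo mid hi}
          (m₁ : Meld i j (suc mid) hi) (m₂ : Meld j k lo mid) →
          TopDec (dec m₁ m₂ ∷ [])

{-# OPTIONS --safe #-}
-- A meld on positions i, …, k−1 with entries lo, …, hi has k − i = hi − lo + 1, so the meld
-- spanning all n positions has entries 1, …, n.  If it is (m₁, m₂) with m₁ on the first j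
-- positions, m₁ thus carries exactly the entries 1, …, j, and π fixes {1, …, j}.  If it is
-- [m₁, m₂], the first j positions carry the entries above some t with 1 ≤ t < n and the others
-- the entries up to t.  Were {1, …, k} fixed with k ≥ j, the entry k + 1 would lie beyond the
-- first k positions, forcing k < t, and the entry t + 1 among the first j ≤ k, forcing t < k;
-- with k < j, the entry 1 would lie among the first j positions, forcing t < 1.
module Submission where

open import Defs
open import Data.Nat using (ℕ; suc; _+_; _≤_; _<_; _≤?_; _<?_; s≤s; z≤n)
open import Data.Nat.Properties
open import Data.Nat.Tactic.RingSolver using (solve)
open import Data.List using ([]; _∷_)
open import Data.Fin using (Fin; toℕ; fromℕ<)
open import Data.Fin.Properties using (toℕ<n; toℕ-fromℕ<; toℕ-injective)
open import Data.Fin.Permutation using (Permutation′; _⟨$⟩ʳ_; _⟨$⟩ˡ_; inverseʳ)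
open import Data.Product using (Σ; _×_; _,_; proj₁; proj₂)
open import Data.Sum using (_⊎_; inj₁; inj₂; [_,_])
open import Data.Empty using (⊥-elim)
open import Function using (id; _∘_)
open import Function.Bundles using (_⇔_; mk⇔)
open import Relation.Nullary using (¬_; yes; no)
open import Relation.Binary.PropositionalEquality using (_≡_; refl; sym; trans; cong; cong₂; subst; module ≡-Reasoning)

⇔-from-cases : {A B D : Set} → (A → D) → (B → ¬ D) → A ⊎ B → ((¬ D) ⇔ B) × (D ⇔ A)
⇔-from-cases A⇒D B⇒¬D A⊎B =
  mk⇔ (λ ¬d → [ ⊥-elim ∘ ¬d ∘ A⇒D , id ] A⊎B) B⇒¬D ,
  mk⇔ (λ d → [ id , (λ b → ⊥-elim (B⇒¬D b d)) ] A⊎B) A⇒D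

module _ {n : ℕ} (π : Permutation′ n) where

  preimage : ∀ {v} → v < n → Σ (Fin n) λ p → toℕ (π ⟨$⟩ʳ p) ≡ v
  preimage v<n = π ⟨$⟩ˡ fromℕ< v<n , trans (cong toℕ (inverseʳ π)) (toℕ-fromℕ< v<n)

  preserves-blocks⇒FixesInitialSegment : ∀ {k} →
    (∀ p → toℕ p < k → toℕ (π ⟨$⟩ʳ p) < k) →
    (∀ p → k ≤ toℕ p → k ≤ toℕ (π ⟨$⟩ʳ p)) →
    FixesInitialSegment π k
  preserves-blocks⇒FixesInitialSegment {k} below above =
    below , λ v v<k → π ⟨$⟩ˡ v , preimage-below v v<k , inverseʳ π
    where
    preimage-below : ∀ v → toℕ v < k → toℕ (π ⟨$⟩ˡ v) < k
    preimage-below v v<k = ≰⇒> λ k≤p →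
      <⇒≱ v<k (subst (λ w → k ≤ toℕ w) (inverseʳ π) (above (π ⟨$⟩ˡ v) k≤p))

  swaps-blocks⇒Indecomposable : ∀ {j t} → 0 < t → t < n →
    (∀ p → toℕ p < j → t ≤ toℕ (π ⟨$⟩ʳ p)) →
    (∀ p → j ≤ toℕ p → toℕ (π ⟨$⟩ʳ p) < t) →
    Indecomposable π
  swaps-blocks⇒Indecomposable {j} {t} 0<t t<n left right (k , 1≤k , k<n , below , onto)
    with j ≤? k
  ... | yes j≤k = <-asym k<t t<k
    where
    k<t : k < t
    k<t with preimage k<n
    ... | p , πp≡k = subst (_< t) πp≡k (right p (≤-trans j≤k (≮⇒≥ (<-irrefl πp≡k ∘ below p))))
    t<k : t < k
    t<k with preimage t<n
    ... | q , πq≡t = subst (_< k) πq≡t (below q (<-≤-trans (≰⇒> (<-irrefl πq≡t ∘ right q)) j≤k))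
  ... | no j≰k with onto (fromℕ< (<-trans 1≤k k<n)) (subst (_< k) (sym (toℕ-fromℕ< _)) 1≤k)
  ...   | q , q<k , πq≡0 =
    <⇒≱ 0<t (subst (t ≤_) (trans (cong toℕ πq≡0) (toℕ-fromℕ< _)) (left q (<-trans q<k (≰⇒> j≰k))))

module _ {n : ℕ} {π : Permutation′ n} where

  meld-lo≤hi : ∀ {i k lo hi} → Meld π i k lo hi → lo ≤ hi
  meld-lo≤hi (single j)  = ≤-refl
  meld-lo≤hi (inc m₁ m₂) = ≤-trans (meld-lo≤hi m₁) (<⇒≤ (meld-lo≤hi m₂))
  meld-lo≤hi (dec m₁ m₂) = ≤-trans (meld-lo≤hi m₂) (<⇒≤ (meld-lo≤hi m₁))

  meld-1≤lo : ∀ {i k lo hi} → Meld π i k lo hi → 1 ≤ lo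
  meld-1≤lo (single j)  = s≤s z≤n
  meld-1≤lo (inc m₁ m₂) = meld-1≤lo m₁
  meld-1≤lo (dec m₁ m₂) = meld-1≤lo m₂

  meld-hi≤n : ∀ {i k lo hi} → Meld π i k lo hi → hi ≤ n
  meld-hi≤n (single j)  = toℕ<n (π ⟨$⟩ʳ j)
  meld-hi≤n (inc m₁ m₂) = meld-hi≤n m₂
  meld-hi≤n (dec m₁ m₂) = meld-hi≤n m₁

  meld-i<k : ∀ {i k lo hi} → Meld π i k lo hi → i < k
  meld-i<k (single j)  = ≤-refl
  meld-i<k (inc m₁ m₂) = <-trans (meld-i<k m₁) (meld-i<k m₂)
  meld-i<k (dec m₁ m₂) = <-trans (meld-i<k m₁) (meld-i<k m₂)

  meld-width : ∀ {i k lo hi} → Meld π i k lo hi → k + lo ≡ suc (i + hi)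
  meld-width (single j) = refl
  meld-width {i} {k} {lo} {hi} (inc {j = j} {mid = mid} m₁ m₂) =
    +-cancelʳ-≡ (j + suc mid) (k + lo) (suc (i + hi)) (begin
      (k + lo) + (j + suc mid)     ≡⟨ solve (k ∷ lo ∷ j ∷ mid ∷ []) ⟩
      (k + suc mid) + (j + lo)     ≡⟨ cong₂ _+_ (meld-width m₂) (meld-width m₁) ⟩
      suc (j + hi) + suc (i + mid) ≡⟨ solve (i ∷ j ∷ mid ∷ hi ∷ []) ⟩
      suc (i + hi) + (j + suc mid) ∎)
    where open ≡-Reasoning
  meld-width (dec {j = j} {mid = mid} m₁ m₂) =
    trans (meld-width m₂) (trans (sym (+-suc j mid)) (meld-width m₁))

  meld-entry∈[lo,hi] : ∀ {i k lo hi} → Meld π i k lo hi →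
    ∀ p → i ≤ toℕ p → toℕ p < k → lo ≤ entry π p × entry π p ≤ hi
  meld-entry∈[lo,hi] (single j) p i≤p p<k
    rewrite toℕ-injective {i = p} {j = j} (≤-antisym (≤-pred p<k) i≤p) = ≤-refl , ≤-refl
  meld-entry∈[lo,hi] (inc {j = j} m₁ m₂) p i≤p p<k with toℕ p <? j
  ... | yes p<j = let lo≤e , e≤mid = meld-entry∈[lo,hi] m₁ p i≤p p<j
                  in lo≤e , ≤-trans e≤mid (<⇒≤ (meld-lo≤hi m₂))
  ... | no p≮j  = let mid<e , e≤hi = meld-entry∈[lo,hi] m₂ p (≮⇒≥ p≮j) p<k
                  in ≤-trans (meld-lo≤hi m₁) (<⇒≤ mid<e) , e≤hi
  meld-entry∈[lo,hi] (dec {j = j} m₁ m₂) p i≤p p<k with toℕ p <? j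
  ... | yes p<j = let mid<e , e≤hi = meld-entry∈[lo,hi] m₁ p i≤p p<j
                  in ≤-trans (meld-lo≤hi m₂) (<⇒≤ mid<e) , e≤hi
  ... | no p≮j  = let lo≤e , e≤mid = meld-entry∈[lo,hi] m₂ p (≮⇒≥ p≮j) p<k
                  in lo≤e , ≤-trans e≤mid (<⇒≤ (meld-lo≤hi m₁))

  spanning-meld-lo≡1 : ∀ {lo hi} → Meld π 0 n lo hi → lo ≡ 1
  spanning-meld-lo≡1 {lo} {hi} m = ≤-antisym (+-cancelˡ-≤ n lo 1 n+lo≤n+1) (meld-1≤lo m)
    where
    open ≤-Reasoning
    n+lo≤n+1 : n + lo ≤ n + 1
    n+lo≤n+1 = begin
      n + lo ≡⟨ meld-width m ⟩
      suc hi ≤⟨ s≤s (meld-hi≤n m) ⟩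
      suc n  ≡⟨ +-comm 1 n ⟩
      n + 1  ∎

  SingleMeld⇒TopInc⊎TopDec : ∀ {i k} {c : Chain π i k} → SingleMeld π c → suc i < k →
    TopInc π c ⊎ TopDec π c
  SingleMeld⇒TopInc⊎TopDec (one (single j))  i+1<k = ⊥-elim (<-irrefl refl i+1<k)
  SingleMeld⇒TopInc⊎TopDec (one (inc m₁ m₂)) _     = inj₁ (top m₁ m₂)
  SingleMeld⇒TopInc⊎TopDec (one (dec m₁ m₂)) _     = inj₂ (top m₁ m₂)

  TopInc⇒Decomposable : {c : Chain π 0 n} → TopInc π c → Decomposable π
  TopInc⇒Decomposable (top {j = j} {lo = lo} {mid = mid} m₁ m₂) =
    j , meld-i<k m₁ , meld-i<k m₂ , preserves-blocks⇒FixesInitialSegment π below above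
    where
    j≡mid : j ≡ mid
    j≡mid = suc-injective (begin
      suc j   ≡⟨ +-comm 1 j ⟩
      j + 1   ≡⟨ cong (j +_) (sym (spanning-meld-lo≡1 (inc m₁ m₂))) ⟩
      j + lo  ≡⟨ meld-width m₁ ⟩
      suc mid ∎)
      where open ≡-Reasoning
    below : ∀ p → toℕ p < j → toℕ (π ⟨$⟩ʳ p) < j
    below p p<j = subst (entry π p ≤_) (sym j≡mid) (proj₂ (meld-entry∈[lo,hi] m₁ p z≤n p<j))
    above : ∀ p → j ≤ toℕ p → j ≤ toℕ (π ⟨$⟩ʳ p)
    above p j≤p = subst (_≤ toℕ (π ⟨$⟩ʳ p)) (sym j≡mid)
      (≤-pred (proj₁ (meld-entry∈[lo,hi] m₂ p j≤p (toℕ<n p))))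

  TopDec⇒Indecomposable : {c : Chain π 0 n} → TopDec π c → Indecomposable π
  TopDec⇒Indecomposable (top m₁ m₂) =
    swaps-blocks⇒Indecomposable π
      (≤-trans (meld-1≤lo m₂) (meld-lo≤hi m₂))
      (≤-trans (meld-lo≤hi m₁) (meld-hi≤n m₁))
      (λ p p<j → ≤-pred (proj₁ (meld-entry∈[lo,hi] m₁ p z≤n p<j)))
      (λ p j≤p → proj₂ (meld-entry∈[lo,hi] m₂ p j≤p (toℕ<n p)))

lemma4p3 : (n : ℕ) → 2 ≤ n → (π : Permutation′ n) → Full π →
    (c₀ c : Chain π 0 n) → AllSingle π c₀ → Steps π c₀ c → Terminal π c →
    SingleMeld π c →
    (Indecomposable π ⇔ TopDec π c) × (Decomposable π ⇔ TopInc π c)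
lemma4p3 n 2≤n π _ _ _ _ _ _ c-single =
  ⇔-from-cases TopInc⇒Decomposable TopDec⇒Indecomposable (SingleMeld⇒TopInc⊎TopDec c-single 2≤n)
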